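{- Define the sequence $c$ by $c(1)=2$ and, for $n\ge 2$, $$c(n)=c(n-1)+\begin{cases}\gcd(n,\,c(n-1)), & n \text{ even},\\ \gcd(n-2,\,c(n-1)), & n\text{ odd}.\end{cases}$$ Call $n$ a fundamental point if $c(n)=2n$. Let $m\ge 12$ be a fundamental point with $m\equiv 0\pmod 6$ such that $m-1$ and $m+1$ are twin primes, and suppose a next fundamental point $m'>m$ exists (no fundamental point strictly between $m$ and $m'$). Let $m+3+l_1<\dots<m+3+l_h$ be the integers $n$ with $m+3<n<m'$ and $c(n)-c(n-1)>1$, with sizes $t_j=c(m+3+l_j)-c(m+3+l_j-1)$, and let $T_h=t_1+\dots+t_h$. Then $T_h-h$ is even. -}

module Defs where

open import Data.Nat using (ℕ; zero; suc; _+_; _*_; _∸_; _<_; _≤_; _<ᵇ_; _%_)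
open import Relation.Binary.PropositionalEquality using (_≡_)
open import Data.Nat.GCD using (gcd)
open import Data.Bool using (Bool; true; false; if_then_else_)
open import Data.List using (List; []; _∷_; filterᵇ; map; length; sum; upTo)

-- c n for n ≥ 1 ; c 0 is an irrelevant dummy value (0).
-- cS k = c (k + 1).
cS : ℕ → ℕ
cS zero = 2
cS (suc k) with (suc (suc k)) % 2
... | zero  = cS k + gcd (suc (suc k)) (cS k)
... | suc _ = cS k + gcd k (cS k)                 -- n = k+2 odd, n - 2 = k

c : ℕ → ℕ
c zero = 0
c (suc k) = cS k

-- increment c(n) - c(n-1)  (meaningful for n ≥ 2)
δ : ℕ → ℕ
δ n = c n ∸ c (n ∸ 1)

FundamentalPoint : ℕ → Set
FundamentalPoint n = c n ≡ 2 * n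

openRange : ℕ → ℕ → List ℕ
openRange a b = map (λ i → suc a + i) (upTo (b ∸ suc a))

jumpPoints : ℕ → ℕ → List ℕ
jumpPoints m m' = filterᵇ (λ n → 1 <ᵇ δ n) (openRange (m + 3) m')

jumpSizes : ℕ → ℕ → List ℕ
jumpSizes m m' = map δ (jumpPoints m m')

-- Say that n is "in phase" when c(n) ≡ n (mod 2).  A fundamental point m
-- with m even is in phase, since c(m) = 2m.  Being in phase propagates:
-- if c(n) ≡ n (mod 2), the next increment is odd — for n+1 even it is
-- gcd(n+1, c(n)), a divisor of the odd number c(n); for n+1 odd it is
-- gcd(n-1, c(n)), a divisor of the odd number n-1 — and adding an odd
-- increment gives c(n+1) ≡ n+1 (mod 2).  Hence every increment δ(n) with
-- n > m is odd, in particular every jump size t_j, and a sum of h odd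
-- numbers exceeds h by an even number.  Only m even and c(m) = 2m are used.
module Submission where

open import Defs
open import Data.Nat using (ℕ; _+_; _∸_; _*_; _<_; _<ᵇ_; _≤_; _≤′_; ≤′-refl; ≤′-step; _%_; zero; suc; s≤s)
open import Data.Nat.Divisibility
  using (_∣_; divides; ∣-refl; ∣-trans; ∣1⇒≡1; ∣m+n∣m⇒∣n; ∣m∣n⇒∣m+n; m∣m*n; m%n≡0⇒n∣m; n∣m⇒m%n≡0)
open import Data.Nat.Primality using (Prime)
open import Data.Nat.Properties using (+-comm; m≤m+n; ≤-trans; m+n∸m≡n; ≤⇒≤′)
open import Data.Nat.GCD using (gcd; gcd[m,n]∣m; gcd[m,n]∣n)
open import Data.Nat.ListAction using (sum)
open import Data.Nat.Tactic.RingSolver using (solve-∀)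
open import Data.List using ([]; _∷_; length; upTo)
open import Data.List.Relation.Unary.All using (All; []; _∷_; universal)
import Data.List.Relation.Unary.All as All
import Data.List.Relation.Unary.All.Properties as AllP
open import Data.Product using (Σ; _,_; _×_)
open import Data.Empty using (⊥-elim)
open import Relation.Binary.PropositionalEquality using (_≡_; refl; sym; trans; cong; subst)
open import Relation.Nullary using (¬_)
open import Relation.Nullary.Decidable using (T?)

Odd : ℕ → Set
Odd n = ¬ 2 ∣ n

consecutive-not-even : ∀ {n} → 2 ∣ n → ¬ 2 ∣ suc n
consecutive-not-even {n} 2∣n 2∣1+n
  with ∣1⇒≡1 (∣m+n∣m⇒∣n (subst (2 ∣_) (+-comm 1 n) 2∣1+n) 2∣n)
... | ()

odd-divisor : ∀ {d n} → d ∣ n → Odd n → Odd d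
odd-divisor d∣n odd-n 2∣d = odd-n (∣-trans 2∣d d∣n)

odd⇒suc-double : ∀ n → Odd n → Σ ℕ λ q → n ≡ suc (q * 2)
odd⇒suc-double zero          odd-n = ⊥-elim (odd-n (divides 0 refl))
odd⇒suc-double (suc zero)    _     = 0 , refl
odd⇒suc-double (suc (suc n)) odd-n
  with odd⇒suc-double n (λ 2∣n → odd-n (∣m∣n⇒∣m+n ∣-refl 2∣n))
... | q , n≡ = suc q , cong (λ x → suc (suc x)) n≡

odd⇒even-suc : ∀ {n} → Odd n → 2 ∣ suc n
odd⇒even-suc {n} odd-n with odd⇒suc-double n odd-n
... | q , refl = divides (suc q) refl

InPhase : ℕ → Set
InPhase n = 2 ∣ c n + n

fundamental⇒inPhase : ∀ {m} → FundamentalPoint m → 2 ∣ m → InPhase m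
fundamental⇒inPhase {m} fp 2∣m =
  subst (λ x → 2 ∣ x + m) (sym fp) (∣m∣n⇒∣m+n (m∣m*n m) 2∣m)

odd-increment : ∀ k → InPhase (suc k) → Σ ℕ λ g → c (suc (suc k)) ≡ c (suc k) + g × Odd g
odd-increment k inPhase with suc (suc k) % 2 in parity
... | zero  = gcd (suc (suc k)) (cS k) , refl , odd-divisor (gcd[m,n]∣n (suc (suc k)) (cS k)) odd-c
  where
  -- n+1 is even, so n is odd, and hence so is c(n) ≡ n (mod 2).
  odd-c : Odd (cS k)
  odd-c 2∣c = consecutive-not-even (∣m+n∣m⇒∣n inPhase 2∣c) (m%n≡0⇒n∣m (suc (suc k)) 2 parity)
... | suc _ = gcd k (cS k) , refl , odd-divisor (gcd[m,n]∣m k (cS k)) odd-k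
  where
  -- n+1 is odd, so n-1 = k is odd.
  odd-k : Odd k
  odd-k 2∣k with trans (sym parity) (n∣m⇒m%n≡0 (2 + k) 2 (∣m∣n⇒∣m+n ∣-refl 2∣k))
  ... | ()

inPhase-step : ∀ k → InPhase (suc k) → InPhase (suc (suc k))
inPhase-step k inPhase with odd-increment k inPhase
... | g , c≡ , odd-g =
  subst (2 ∣_) (sym rearrange) (∣m∣n⇒∣m+n inPhase (odd⇒even-suc odd-g))
  where
  regroup : ∀ a g k → a + g + (2 + k) ≡ a + (1 + k) + (1 + g)
  regroup = solve-∀
  rearrange : c (suc (suc k)) + suc (suc k) ≡ c (suc k) + suc k + suc g
  rearrange = trans (cong (_+ suc (suc k)) c≡) (regroup (c (suc k)) g k)

inPhase-beyond : ∀ {p n} → InPhase (suc p) → p ≤′ n → InPhase (suc n)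
inPhase-beyond inPhase ≤′-refl         = inPhase
inPhase-beyond inPhase (≤′-step p≤′n) = inPhase-step _ (inPhase-beyond inPhase p≤′n)

δ-odd-beyond : ∀ {p} → InPhase (suc p) → ∀ n → suc p < n → Odd (δ n)
δ-odd-beyond inPhase (suc (suc k)) (s≤s (s≤s p≤k))
  with odd-increment k (inPhase-beyond inPhase (≤⇒≤′ p≤k))
... | g , c≡ , odd-g = subst Odd (sym δ≡g) odd-g
  where
  δ≡g : δ (suc (suc k)) ≡ g
  δ≡g = trans (cong (_∸ c (suc k)) c≡) (m+n∸m≡n (c (suc k)) g)

sum-of-odds : ∀ xs → All Odd xs → Σ ℕ λ q → sum xs ≡ length xs + q * 2
sum-of-odds []       []             = 0 , refl
sum-of-odds (x ∷ xs) (odd-x ∷ odds) with odd⇒suc-double x odd-x | sum-of-odds xs odds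
... | h , refl | q , sum≡ = h + q , trans (cong (suc (h * 2) +_) sum≡) (regroup h q (length xs))
  where
  regroup : ∀ h q l → suc (h * 2) + (l + q * 2) ≡ suc l + (h + q) * 2
  regroup = solve-∀

sum∸length-even : ∀ xs → All Odd xs → 2 ∣ sum xs ∸ length xs
sum∸length-even xs odds with sum-of-odds xs odds
... | q , sum≡ = divides q (trans (cong (_∸ length xs) sum≡) (m+n∸m≡n (length xs) (q * 2)))

openRange-beyond : ∀ a b → All (a <_) (openRange a b)
openRange-beyond a b = AllP.map⁺ (universal (m≤m+n (suc a)) (upTo (b ∸ suc a)))

jumpPoints-beyond : ∀ m m' → All (m + 3 <_) (jumpPoints m m')
jumpPoints-beyond m m' = AllP.filter⁺ (λ n → T? (1 <ᵇ δ n)) (openRange-beyond (m + 3) m')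

mainTheorem5 : (m m' : ℕ) → 12 ≤ m → FundamentalPoint m → m % 6 ≡ 0
    → Prime (m ∸ 1) → Prime (m + 1)
    → m < m' → FundamentalPoint m'
    → (∀ n → m < n → n < m' → ¬ FundamentalPoint n)
    → 2 ∣ (sum (jumpSizes m m') ∸ length (jumpSizes m m'))
mainTheorem5 (suc p) m' _ fp m%6≡0 _ _ _ _ _ =
  sum∸length-even (jumpSizes (suc p) m')
    (AllP.map⁺ (All.map odd-jump (jumpPoints-beyond (suc p) m')))
  where
  m-even : 2 ∣ suc p
  m-even = ∣-trans (divides 3 refl) (m%n≡0⇒n∣m (suc p) 6 m%6≡0)
  odd-jump : ∀ {n} → suc p + 3 < n → Odd (δ n)
  odd-jump {n} m+3<n = δ-odd-beyond (fundamental⇒inPhase fp m-even) n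
    (≤-trans (s≤s (m≤m+n (suc p) 3)) m+3<n)
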